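{- The class ${BiG}^{\ast}_{\mathrm{fin}}$ is $\Sigma_1$-interpretable (without parameters) in the class ${2Eq}_{\mathrm{fin}}$.
   Context: Signatures contain no function symbols. ${BiG}^{\ast}_{\mathrm{fin}}$ is the class of all finite structures in the signature $\{L^1,R^1,E^2\}$ satisfying $\forall x\,(L(x)\leftrightarrow\neg R(x))\wedge\forall x\forall y\,(E(x,y)\to L(x)\wedge R(y))$ (finite bipartite graphs) in which each of $L$ and $R$ contains at least three elements. ${2Eq}_{\mathrm{fin}}$ is the class of all finite structures in the signature $\{P^2,Q^2\}$ in which both $P$ and $Q$ are equivalence relations. A $\sigma_2$-scheme in $\sigma_1$ (without parameters) is a collection of $\sigma_2$-formulas $\Phi_U(x)$ and, for each $n$-ary predicate symbol $R$ of $\sigma_1$, formulas $\Phi_R(x_1,\dots,x_n)$ and $\Phi_{\neg R}(x_1,\dots,x_n)$. For $\mathcal{K}_1$ a class of $\sigma_1$-structures and $\mathcal{K}_2$ a class of $\sigma_2$-structures, $\mathcal{K}_1$ is interpretable in $\mathcal{K}_2$ if there is such a scheme such that for every $\mathfrak{A}\in\mathcal{K}_1$ there is $\mathfrak{B}\in\mathcal{K}_2$ with: (1) $B':=\{b\in B:\mathfrak{B}\models\Phi_U(b)\}$ is nonempty; (2) for every $n$-ary $R$ of $\sigma_1$ and all $\bar b\in (B')^n$, $\mathfrak{B}\models\Phi_{\neg R}(\bar b)$ iff $\mathfrak{B}\not\models\Phi_R(\bar b)$; (3) $\mathfrak{A}$ is isomorphic to the $\sigma_1$-structure $\mathfrak{B}'$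 with universe $B'$ in which $\mathfrak{B}'\models R(\bar b)$ iff $\mathfrak{B}\models\Phi_R(\bar b)$. It is $\Sigma_k$-interpretable if moreover all formulas of the scheme are $\Sigma_k$-formulas (prenex formulas with exactly $k$ alternating quantifier blocks starting with $\exists$ and quantifier-free matrix). -}

module Defs where

open import Data.Nat using (ℕ; zero; suc)
open import Data.Fin using (Fin)
open import Data.Bool using (Bool; true; false; not)
open import Data.Sum using (_⊎_; inj₁; inj₂; [_,_])
open import Data.Product using (Σ; Σ-syntax; ∃; ∃-syntax; _×_; _,_)
open import Data.Empty using (⊥)
open import Data.Unit using (⊤)
open import Relation.Nullary using (¬_)
open import Relation.Binary.PropositionalEquality using (_≡_; _≢_)

-- Finite structures.  Universes are Fin N; relations are Bool-valued
-- (finite structures, so relations are decidable).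

record Str₂ : Set where
  field
    size : ℕ
    P Q  : Fin size → Fin size → Bool

record Str₁ : Set where
  field
    size : ℕ
    L R  : Fin size → Bool
    E    : Fin size → Fin size → Bool

IsEquivalenceB : {N : ℕ} → (Fin N → Fin N → Bool) → Set
IsEquivalenceB {N} ρ =
  (∀ x → ρ x x ≡ true) ×
  (∀ x y → ρ x y ≡ true → ρ y x ≡ true) ×
  (∀ x y z → ρ x y ≡ true → ρ y z ≡ true → ρ x z ≡ true)

In2Eq : Str₂ → Set
In2Eq B = IsEquivalenceB (Str₂.P B) × IsEquivalenceB (Str₂.Q B)

AtLeastThree : {N : ℕ} → (Fin N → Bool) → Set
AtLeastThree {N} U =
  Σ[ x ∈ Fin N ] Σ[ y ∈ Fin N ] Σ[ z ∈ Fin N ]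
    (U x ≡ true × U y ≡ true × U z ≡ true × x ≢ y × x ≢ z × y ≢ z)

InBiG* : Str₁ → Set
InBiG* A =
  (∀ x → (L x ≡ true → ¬ (R x ≡ true)) × (¬ (R x ≡ true) → L x ≡ true)) ×
  (∀ x y → E x y ≡ true → L x ≡ true × R y ≡ true) ×
  AtLeastThree L × AtLeastThree R
  where open Str₁ A

data QF (V : Set) : Set where
  tt ff     : QF V
  eq        : V → V → QF V
  atP atQ   : V → V → QF V
  neg       : QF V → QF V
  _and_ _or_ : QF V → QF V → QF V

-- Σ₁-formulas with n free variables: ∃ y₀ … y_k . matrix,
-- one (nonempty) block of existential quantifiers, quantifier-free matrix.
record Σ₁Formula (n : ℕ) : Set where
  constructor ∃block
  field
    k      : ℕ
    matrix : QF (Fin n ⊎ Fin (suc k))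

module _ (B : Str₂) where
  open Str₂ B

  SatQF : {V : Set} → (V → Fin size) → QF V → Set
  SatQF ρ tt        = ⊤
  SatQF ρ ff        = ⊥
  SatQF ρ (eq x y)  = ρ x ≡ ρ y
  SatQF ρ (atP x y) = P (ρ x) (ρ y) ≡ true
  SatQF ρ (atQ x y) = Q (ρ x) (ρ y) ≡ true
  SatQF ρ (neg φ)   = ¬ SatQF ρ φ
  SatQF ρ (φ and ψ) = SatQF ρ φ × SatQF ρ ψ
  SatQF ρ (φ or ψ)  = SatQF ρ φ ⊎ SatQF ρ ψ

  SatΣ₁ : {n : ℕ} → Σ₁Formula n → (Fin n → Fin size) → Set
  SatΣ₁ (∃block k φ) ρ = Σ[ w ∈ (Fin (suc k) → Fin size) ] SatQF [ ρ , w ] φ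

record Σ₁Scheme : Set where
  field
    ΦU         : Σ₁Formula 1
    ΦL  Φ¬L    : Σ₁Formula 1
    ΦR  Φ¬R    : Σ₁Formula 1
    ΦE  Φ¬E    : Σ₁Formula 2

one : {A : Set} → A → Fin 1 → A
one a _ = a

two : {A : Set} → A → A → Fin 2 → A
two a b Fin.zero    = a
two a b (Fin.suc _) = b

_⇔ₛ_ : Set → Set → Set
X ⇔ₛ Y = (X → Y) × (Y → X)

-- Conditions (1)-(3) of the definition of interpretability, for the
-- scheme S, the σ₁-structure A and the σ₂-structure B.
Interprets : Σ₁Scheme → Str₁ → Str₂ → Set
Interprets S A B =
  (Σ[ b ∈ Fin NB ] InU b) ×
  (∀ b → InU b → SatΣ₁ B Φ¬L (one b) ⇔ₛ (¬ SatΣ₁ B ΦL (one b))) ×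
  (∀ b → InU b → SatΣ₁ B Φ¬R (one b) ⇔ₛ (¬ SatΣ₁ B ΦR (one b))) ×
  (∀ b b' → InU b → InU b' →
     SatΣ₁ B Φ¬E (two b b') ⇔ₛ (¬ SatΣ₁ B ΦE (two b b'))) ×
  (Σ[ f ∈ (Fin NA → Fin NB) ]
     (∀ a a' → f a ≡ f a' → a ≡ a') ×
     (∀ a → InU (f a)) ×
     (∀ b → InU b → Σ[ a ∈ Fin NA ] f a ≡ b) ×
     (∀ a → (Str₁.L A a ≡ true) ⇔ₛ SatΣ₁ B ΦL (one (f a))) ×
     (∀ a → (Str₁.R A a ≡ true) ⇔ₛ SatΣ₁ B ΦR (one (f a))) ×
     (∀ a a' → (Str₁.E A a a' ≡ true) ⇔ₛ SatΣ₁ B ΦE (two (f a) (f a'))))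
  where
    open Σ₁Scheme S
    NA = Str₁.size A
    NB = Str₂.size B
    InU : Fin NB → Set
    InU b = SatΣ₁ B ΦU (one b)

BiG*Σ₁InterpretableIn2Eq : Set
BiG*Σ₁InterpretableIn2Eq =
  Σ[ S ∈ Σ₁Scheme ] ((A : Str₁) → InBiG* A →
     Σ[ B ∈ Str₂ ] (In2Eq B × Interprets S A B))

module Submission where

open import Defs
open import Data.Bool using (Bool; true; false; not; if_then_else_)
  renaming (_∧_ to _∧ᵇ_; _∨_ to _∨ᵇ_)
import Data.Bool as Bool
open import Data.Bool.Properties using (∨-zeroʳ; ¬-not; not-¬)
open import Data.Fin using (Fin; zero; suc; toℕ; fromℕ<; inject≤; _≟_; #_)
open import Data.Fin.Properties
  using (toℕ-injective; toℕ-fromℕ<; toℕ-inject≤; inject≤-injective; toℕ<n; injective⇒≤; +↔⊎; *↔×)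
open import Data.Nat using (ℕ; suc; _+_; _*_; _≤_; _<_; z≤n; s≤s; _<?_)
open import Data.Nat.Properties using (≤-trans; ≤-refl; <-≤-trans)
open import Data.Product using (Σ-syntax; _×_; _,_; proj₁; proj₂; uncurry; map₂)
open import Data.Product.Function.NonDependent.Propositional using (_×-↔_)
open import Data.Sum using (_⊎_; inj₁; inj₂; [_,_])
open import Data.Sum.Properties using (inj₁-injective) renaming (≡-dec to ⊎-≡-dec)
open import Data.Vec using (Vec; []; _∷_; map; lookup; tabulate)
open import Data.Vec.Relation.Unary.All as All using (All; []; _∷_)
open import Data.Vec.Relation.Unary.All.Properties as All using ()
open import Data.Vec.Relation.Unary.AllPairs using ([]; _∷_)
open import Data.Vec.Relation.Unary.Unique.Propositional using (Unique)
open import Data.Vec.Relation.Unary.Unique.Propositional.Properties using (lookup-injective; tabulate⁺)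
open import Function using (_∘_; _↔_; Inverse)
open import Function.Construct.Composition using (_↔-∘_)
open import Function.Properties.Inverse using (↔-refl)
open import Relation.Binary.Definitions using (DecidableEquality)
open import Relation.Binary.PropositionalEquality hiding ([_])
open import Relation.Nullary using (¬_; Dec; yes; no; does; contradiction)
open import Relation.Nullary.Decidable using (dec-true; decidable-stable)

-- A finite structure with two equivalence relations is, up to isomorphism, a table
-- of cell sizes: rows are the P-classes, columns the Q-classes, and cell (r , c)
-- counts the elements of r ∩ c.  An existential formula can say that the row of x
-- contains a cell with at least k elements (k distinct witnesses sharing their P-
-- and Q-class), or that a given cell is occupied.
--
-- A bipartite graph on vertices i < n is coded by a table with rows and columns
-- vert i and aux i.  The vertex i is the only element of the cell (vert i , vert i);
-- the "left marker" (vert i , aux i) has 4 elements if i is left and 3 if it is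
-- right, the "right marker" (aux i , vert i) has 1 element if i is left and 2 if it
-- is right, and the off-diagonal cells (vert i , vert j) are occupied by the edges,
-- read from the left side, and by the non-edges, read from the right side.  Only
-- the left markers have 3 or more elements, which pins down the vertex cells
-- existentially.  Every relation and every non-relation at vertices has a positive
-- witness nearby (a large marker, or an occupied cell in the row or in the
-- transposed position), so the negated formulas of the scheme are Σ₁ as well.

⇔ₛ-sym : ∀ {X Y : Set} → X ⇔ₛ Y → Y ⇔ₛ X
⇔ₛ-sym (f , g) = g , f

⇔ₛ-trans : ∀ {X Y Z : Set} → X ⇔ₛ Y → Y ⇔ₛ Z → X ⇔ₛ Z
⇔ₛ-trans (f , g) (h , k) = h ∘ f , g ∘ k

¬-⇔ₛ : ∀ {X Y : Set} → X ⇔ₛ Y → (¬ X) ⇔ₛ (¬ Y)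
¬-⇔ₛ (f , g) = (λ ¬x → ¬x ∘ g) , (λ ¬y → ¬y ∘ f)

record DefinableCopy (S : Σ₁Scheme) (𝔄 : Str₁) (𝔅 : Str₂) : Set where
  open Σ₁Scheme S
  open Str₁ 𝔄 using (L; R; E)
  field
    embed           : Fin (Str₁.size 𝔄) → Fin (Str₂.size 𝔅)
    embed-injective : ∀ a a′ → embed a ≡ embed a′ → a ≡ a′
    embed-domain    : ∀ a → SatΣ₁ 𝔅 ΦU (one (embed a))
    domain-embed    : ∀ b → SatΣ₁ 𝔅 ΦU (one b) → Σ[ a ∈ Fin (Str₁.size 𝔄) ] embed a ≡ b
    defines-L       : ∀ a → SatΣ₁ 𝔅 ΦL  (one (embed a)) ⇔ₛ (L a ≡ true)
    defines-¬L      : ∀ a → SatΣ₁ 𝔅 Φ¬L (one (embed a)) ⇔ₛ (¬ L a ≡ true)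
    defines-R       : ∀ a → SatΣ₁ 𝔅 ΦR  (one (embed a)) ⇔ₛ (R a ≡ true)
    defines-¬R      : ∀ a → SatΣ₁ 𝔅 Φ¬R (one (embed a)) ⇔ₛ (¬ R a ≡ true)
    defines-E       : ∀ a a′ → SatΣ₁ 𝔅 ΦE  (two (embed a) (embed a′)) ⇔ₛ (E a a′ ≡ true)
    defines-¬E      : ∀ a a′ → SatΣ₁ 𝔅 Φ¬E (two (embed a) (embed a′)) ⇔ₛ (¬ E a a′ ≡ true)

  onDomain : {Pr : Fin (Str₂.size 𝔅) → Set} → (∀ a → Pr (embed a)) →
             ∀ b → SatΣ₁ 𝔅 ΦU (one b) → Pr b
  onDomain pr b b∈U with domain-embed b b∈U
  ... | a , refl = pr a

  interprets : Fin (Str₁.size 𝔄) → Interprets S 𝔄 𝔅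
  interprets a₀ =
    (embed a₀ , embed-domain a₀) ,
    onDomain (λ a → ⇔ₛ-trans (defines-¬L a) (¬-⇔ₛ (⇔ₛ-sym (defines-L a)))) ,
    onDomain (λ a → ⇔ₛ-trans (defines-¬R a) (¬-⇔ₛ (⇔ₛ-sym (defines-R a)))) ,
    (λ b b′ b∈U b′∈U → onDomain (λ a → onDomain (λ a′ →
       ⇔ₛ-trans (defines-¬E a a′) (¬-⇔ₛ (⇔ₛ-sym (defines-E a a′)))) b′ b′∈U) b b∈U) ,
    embed , embed-injective , embed-domain , domain-embed ,
    ⇔ₛ-sym ∘ defines-L , ⇔ₛ-sym ∘ defines-R , (λ a a′ → ⇔ₛ-sym (defines-E a a′))

infixr 4 _∧_
infixr 3 _∨_

_∧_ : {V : Set} → QF V → QF V → QF V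
φ ∧ ψ = φ and ψ

_∨_ : {V : Set} → QF V → QF V → QF V
φ ∨ ψ = φ or ψ

module _ {V : Set} where

  every : ∀ {k} → (V → QF V) → Vec V k → QF V
  every φ []       = tt
  every φ (x ∷ xs) = φ x ∧ every φ xs

  distinct : ∀ {k} → Vec V k → QF V
  distinct []       = tt
  distinct (x ∷ xs) = every (λ y → neg (eq x y)) xs ∧ distinct xs

  rowCluster columnCluster : ∀ {k} → V → Vec V (suc k) → QF V
  rowCluster    v (a ∷ as) = every (λ y → atP v y ∧ atQ a y) (a ∷ as) ∧ distinct (a ∷ as)
  columnCluster v (a ∷ as) = every (λ y → atQ v y ∧ atP a y) (a ∷ as) ∧ distinct (a ∷ as)

  link : V → V → V → QF V
  link x z y = atP x z ∧ atQ z y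

  anchor : V → V → V → V → V → V → QF V
  anchor v a b c t s =
    rowCluster v (a ∷ b ∷ c ∷ []) ∧ neg (atQ v a) ∧ atQ t a ∧ neg (atP t v) ∧ link t s v

module _ (𝔅 : Str₂) {V : Set} (ρ : V → Fin (Str₂.size 𝔅)) where

  every-sound : ∀ {k} {φ : V → QF V} {xs : Vec V k} →
                SatQF 𝔅 ρ (every φ xs) → All (SatQF 𝔅 ρ ∘ φ) xs
  every-sound {xs = []}     _         = []
  every-sound {xs = x ∷ xs} (φx , φs) = φx ∷ every-sound φs

  every-complete : ∀ {k} {φ : V → QF V} {xs : Vec V k} →
                   All (SatQF 𝔅 ρ ∘ φ) xs → SatQF 𝔅 ρ (every φ xs)
  every-complete []         = _
  every-complete (φx ∷ φxs) = φx , every-complete φxs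

  distinct-sound : ∀ {k} {xs : Vec V k} → SatQF 𝔅 ρ (distinct xs) → Unique (map ρ xs)
  distinct-sound {xs = []}     _           = []
  distinct-sound {xs = x ∷ xs} (new , old) = All.map⁺ (every-sound new) ∷ distinct-sound old

  distinct-complete : ∀ {k} {xs : Vec V k} → Unique (map ρ xs) → SatQF 𝔅 ρ (distinct xs)
  distinct-complete {xs = []}     []          = _
  distinct-complete {xs = x ∷ xs} (new ∷ old) =
    every-complete (All.map⁻ new) , distinct-complete old

var₀ : ∀ {n k} → Fin (suc n) ⊎ Fin (suc k)
var₀ = inj₁ zero

var₁ : ∀ {n k} → Fin (suc (suc n)) ⊎ Fin (suc k)
var₁ = inj₁ (suc zero)

ω : ∀ {n k} → Fin (suc k) → Fin n ⊎ Fin (suc k)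
ω = inj₂

φ-domain φ-left φ-right : Σ₁Formula 1
φ-domain = ∃block 4 (anchor var₀ (ω (# 0)) (ω (# 1)) (ω (# 2)) (ω (# 3)) (ω (# 4)))
φ-left   = ∃block 3 (rowCluster var₀ (ω (# 0) ∷ ω (# 1) ∷ ω (# 2) ∷ ω (# 3) ∷ []))
φ-right  = ∃block 1 (columnCluster var₀ (ω (# 0) ∷ ω (# 1) ∷ []))

φ-edge φ-nonedge : Σ₁Formula 2
φ-edge    = ∃block 4 (rowCluster var₀ (ω (# 0) ∷ ω (# 1) ∷ ω (# 2) ∷ ω (# 3) ∷ [])
                      ∧ neg (eq var₀ var₁) ∧ link var₀ (ω (# 4)) var₁)
φ-nonedge = ∃block 6 (columnCluster var₀ (ω (# 0) ∷ ω (# 1) ∷ [])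
                      ∨ rowCluster var₁ (ω (# 2) ∷ ω (# 3) ∷ ω (# 4) ∷ ω (# 5) ∷ [])
                      ∨ link var₁ (ω (# 6)) var₀)

scheme : Σ₁Scheme
scheme = record
  { ΦU = φ-domain
  ; ΦL = φ-left  ; Φ¬L = φ-right
  ; ΦR = φ-right ; Φ¬R = φ-left
  ; ΦE = φ-edge  ; Φ¬E = φ-nonedge
  }

module _ {N : ℕ} {X : Set} (_≟ˣ_ : DecidableEquality X) (f : Fin N → X) where

  agree : Fin N → Fin N → Bool
  agree x y = does (f x ≟ˣ f y)

  agree⇒≡ : ∀ {x y} → agree x y ≡ true → f x ≡ f y
  agree⇒≡ {x} {y} h with f x ≟ˣ f y
  ... | yes fx≡fy = fx≡fy

  ≡⇒agree : ∀ {x y} → f x ≡ f y → agree x y ≡ true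
  ≡⇒agree {x} {y} = dec-true (f x ≟ˣ f y)

  agree-isEquivalence : IsEquivalenceB agree
  agree-isEquivalence =
    (λ _ → ≡⇒agree refl) ,
    (λ _ _ h → ≡⇒agree (sym (agree⇒≡ h))) ,
    (λ _ _ _ h h′ → ≡⇒agree (trans (agree⇒≡ h) (agree⇒≡ h′)))

2≤4 : 2 ≤ 4
2≤4 = s≤s (s≤s z≤n)

3≤4 : 3 ≤ 4
3≤4 = s≤s (s≤s (s≤s z≤n))

-- The structure with contingency table count, realised with four slots per cell.
-- A slot at index ≥ count r c is padding: it gets a private P-label and a private
-- Q-label, so it is a singleton class of both relations.
module Table {R C : Set} (_≟ᴿ_ : DecidableEquality R) (_≟ᶜ_ : DecidableEquality C)
             {N : ℕ} (index : Fin N ↔ ((R × C) × Fin 4)) (count : R → C → ℕ) where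

  open Inverse index using (to; from; strictlyInverseˡ; strictlyInverseʳ)

  cellOf : Fin N → R × C
  cellOf x = proj₁ (to x)

  slotOf : Fin N → Fin 4
  slotOf x = proj₂ (to x)

  member : R → C → Fin 4 → Fin N
  member r c s = from ((r , c) , s)

  Live : Fin N → Set
  Live x = toℕ (slotOf x) < uncurry count (cellOf x)

  abstract
    label : {Y : Set} → (R × C → Y) → Fin N → Y ⊎ Fin N
    label g x with toℕ (slotOf x) <? uncurry count (cellOf x)
    ... | yes _ = inj₁ (g (cellOf x))
    ... | no  _ = inj₂ x

    label-live : ∀ {Y} (g : R × C → Y) {x} → Live x → label g x ≡ inj₁ (g (cellOf x))
    label-live g {x} live with toℕ (slotOf x) <? uncurry count (cellOf x)
    ... | yes _    = refl
    ... | no  dead = contradiction live dead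

    label-dead : ∀ {Y} (g : R × C → Y) {x} → ¬ Live x → label g x ≡ inj₂ x
    label-dead g {x} dead with toℕ (slotOf x) <? uncurry count (cellOf x)
    ... | yes live = contradiction live dead
    ... | no  _    = refl

    label-inj₁ : ∀ {Y} (g : R × C → Y) {x y} → label g x ≡ inj₁ y → Live x × g (cellOf x) ≡ y
    label-inj₁ g {x} lbl with toℕ (slotOf x) <? uncurry count (cellOf x)
    ... | yes live = live , inj₁-injective lbl

    label-inj₂ : ∀ {Y} (g : R × C → Y) {x y} → label g x ≡ inj₂ y → x ≡ y
    label-inj₂ g {x} lbl with toℕ (slotOf x) <? uncurry count (cellOf x)
    label-inj₂ g {x} refl | no _ = refl

  rowLabel : Fin N → R ⊎ Fin N
  rowLabel = label proj₁

  colLabel : Fin N → C ⊎ Fin N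
  colLabel = label proj₂

  _≟ʳ_ : DecidableEquality (R ⊎ Fin N)
  _≟ʳ_ = ⊎-≡-dec _≟ᴿ_ _≟_

  _≟ᵏ_ : DecidableEquality (C ⊎ Fin N)
  _≟ᵏ_ = ⊎-≡-dec _≟ᶜ_ _≟_

  structure : Str₂
  structure = record { size = N ; P = agree _≟ʳ_ rowLabel ; Q = agree _≟ᵏ_ colLabel }

  open Str₂ structure using (P; Q)

  structure-in2Eq : In2Eq structure
  structure-in2Eq = agree-isEquivalence _≟ʳ_ rowLabel , agree-isEquivalence _≟ᵏ_ colLabel

  P⇒≡ : ∀ {x y} → P x y ≡ true → rowLabel x ≡ rowLabel y
  P⇒≡ = agree⇒≡ _≟ʳ_ rowLabel

  Q⇒≡ : ∀ {x y} → Q x y ≡ true → colLabel x ≡ colLabel y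
  Q⇒≡ = agree⇒≡ _≟ᵏ_ colLabel

  ≡⇒P : ∀ {x y} → rowLabel x ≡ rowLabel y → P x y ≡ true
  ≡⇒P = ≡⇒agree _≟ʳ_ rowLabel

  ≡⇒Q : ∀ {x y} → colLabel x ≡ colLabel y → Q x y ≡ true
  ≡⇒Q = ≡⇒agree _≟ᵏ_ colLabel

  InRow : R → Fin N → Set
  InRow r x = rowLabel x ≡ inj₁ r

  InColumn : C → Fin N → Set
  InColumn c x = colLabel x ≡ inj₁ c

  _∈ᶜ_ : Fin N → R × C → Set
  x ∈ᶜ (r , c) = InRow r x × InColumn c x

  Cluster : ∀ {k} → R × C → Vec (Fin N) k → Set
  Cluster cell xs = Unique xs × All (_∈ᶜ cell) xs

  inRow-or-isolated : ∀ x → (Σ[ r ∈ R ] InRow r x) ⊎ (∀ {y} → P x y ≡ true → y ≡ x)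
  inRow-or-isolated x = byLiveness (toℕ (slotOf x) <? uncurry count (cellOf x))
    where
    byLiveness : Dec (Live x) → (Σ[ r ∈ R ] InRow r x) ⊎ (∀ {y} → P x y ≡ true → y ≡ x)
    byLiveness (yes live) = inj₁ (proj₁ (cellOf x) , label-live proj₁ live)
    byLiveness (no dead)  =
      inj₂ λ pxy → label-inj₂ proj₁ (trans (sym (P⇒≡ pxy)) (label-dead proj₁ dead))

  inRow⇒∈ᶜ : ∀ {r x} → InRow r x → x ∈ᶜ (r , proj₂ (cellOf x))
  inRow⇒∈ᶜ x∈r with live , refl ← label-inj₁ proj₁ x∈r = x∈r , label-live proj₂ live

  inColumn⇒∈ᶜ : ∀ {c x} → InColumn c x → x ∈ᶜ (proj₁ (cellOf x) , c)
  inColumn⇒∈ᶜ x∈c with live , refl ← label-inj₁ proj₂ x∈c = label-live proj₁ live , x∈c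

  ∈ᶜ⇒member : ∀ {r c x} → x ∈ᶜ (r , c) → toℕ (slotOf x) < count r c × x ≡ member r c (slotOf x)
  ∈ᶜ⇒member {x = x} (x∈r , x∈c)
    with live , refl ← label-inj₁ proj₁ x∈r | _ , refl ← label-inj₁ proj₂ x∈c =
    live , sym (strictlyInverseʳ x)

  ∈ᶜ-singleton : ∀ {r c x} → count r c ≤ 1 → x ∈ᶜ (r , c) → x ≡ member r c zero
  ∈ᶜ-singleton {x = x} count≤1 x∈ with slotOf x | ∈ᶜ⇒member x∈
  ... | zero  | _ , x≡member   = x≡member
  ... | suc _ | slot<count , _ = contradiction (≤-trans slot<count count≤1) λ { (s≤s ()) }

  occupied : ∀ {r c x} → x ∈ᶜ (r , c) → 0 < count r c
  occupied x∈ = <-≤-trans (s≤s z≤n) (proj₁ (∈ᶜ⇒member x∈))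

  to-member : ∀ r c s → to (member r c s) ≡ ((r , c) , s)
  to-member r c s = strictlyInverseˡ ((r , c) , s)

  member-∈ᶜ : ∀ {r c s} → toℕ s < count r c → member r c s ∈ᶜ (r , c)
  member-∈ᶜ {r} {c} {s} s<count =
    trans (label-live proj₁ live) (cong (inj₁ ∘ proj₁ ∘ proj₁) (to-member r c s)) ,
    trans (label-live proj₂ live) (cong (inj₁ ∘ proj₂ ∘ proj₁) (to-member r c s))
    where
    live : Live (member r c s)
    live = subst (λ p → toℕ (proj₂ p) < uncurry count (proj₁ p)) (sym (to-member r c s)) s<count

  member-injective : ∀ {r c r′ c′ s s′} → member r c s ≡ member r′ c′ s′ →
                     ((r , c) , s) ≡ ((r′ , c′) , s′)
  member-injective {r} {c} {r′} {c′} {s} {s′} same =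
    trans (sym (to-member r c s)) (trans (cong to same) (to-member r′ c′ s′))

  cluster-≤-count : ∀ {k r c} {xs : Vec (Fin N) k} → Cluster (r , c) xs → k ≤ count r c
  cluster-≤-count {k} {r} {c} {xs} (unique , inCell) = injective⇒≤ {f = slot} slot-injective
    where
    slot : Fin k → Fin (count r c)
    slot i = fromℕ< (proj₁ (∈ᶜ⇒member (All.lookup⁺ inCell i)))

    slot-injective : ∀ {i j} → slot i ≡ slot j → i ≡ j
    slot-injective {i} {j} same = lookup-injective unique i j (begin
      lookup xs i                       ≡⟨ proj₂ (∈ᶜ⇒member (All.lookup⁺ inCell i)) ⟩
      member r c (slotOf (lookup xs i)) ≡⟨ cong (member r c) (toℕ-injective sameSlot) ⟩
      member r c (slotOf (lookup xs j)) ≡⟨ proj₂ (∈ᶜ⇒member (All.lookup⁺ inCell j)) ⟨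
      lookup xs j                       ∎)
      where
      open ≡-Reasoning
      sameSlot : toℕ (slotOf (lookup xs i)) ≡ toℕ (slotOf (lookup xs j))
      sameSlot = trans (sym (toℕ-fromℕ< _)) (trans (cong toℕ same) (toℕ-fromℕ< _))

  firstMembers : ∀ {k} → R → C → k ≤ 4 → Fin k → Fin N
  firstMembers r c k≤4 s = member r c (inject≤ s k≤4)

  firstMembers-cluster : ∀ {k r c} (k≤4 : k ≤ 4) → k ≤ count r c →
                         Cluster (r , c) (tabulate (firstMembers r c k≤4))
  firstMembers-cluster {r = r} {c} k≤4 k≤count =
    tabulate⁺ (λ same → inject≤-injective k≤4 k≤4 _ _ (cong proj₂ (member-injective same))) ,
    All.tabulate⁺ λ s →
      member-∈ᶜ (subst (_< count r c) (sym (toℕ-inject≤ s k≤4)) (<-≤-trans (toℕ<n s) k≤count))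

  -- What φ-domain sees of the cell (r , c) of an element: a cell with at least three
  -- elements elsewhere in its row, and another row meeting both columns.
  Anchored : R → C → Set
  Anchored r c = Σ[ c′ ∈ C ] Σ[ r′ ∈ R ]
    c′ ≢ c × 3 ≤ count r c′ × r′ ≢ r × 0 < count r′ c′ × 0 < count r′ c

  module _ {V : Set} (ρ : V → Fin N) where

    rowCluster-sound : ∀ {k r} v a (as : Vec V k) → SatQF structure ρ (rowCluster v (a ∷ as)) →
                       InRow r (ρ v) → Σ[ c ∈ C ] InColumn c (ρ a) × suc k ≤ count r c
    rowCluster-sound {r = r} v a as (sameCell , dist) v∈r =
      c , a∈c , cluster-≤-count (distinct-sound structure ρ dist ,
                                 All.map⁺ (All.map inCell (every-sound structure ρ sameCell)))
      where
      c = proj₂ (cellOf (ρ a))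
      a∈c = proj₂ (inRow⇒∈ᶜ (trans (sym (P⇒≡ (proj₁ (All.head (every-sound structure ρ sameCell))))) v∈r))
      inCell : ∀ {y} → P (ρ v) (ρ y) ≡ true × Q (ρ a) (ρ y) ≡ true → ρ y ∈ᶜ (r , c)
      inCell (pvy , qay) = trans (sym (P⇒≡ pvy)) v∈r , trans (sym (Q⇒≡ qay)) a∈c

    rowCluster-complete : ∀ {k r c} v a (as : Vec V k) → InRow r (ρ v) →
                          Cluster (r , c) (map ρ (a ∷ as)) → SatQF structure ρ (rowCluster v (a ∷ as))
    rowCluster-complete {r = r} {c} v a as v∈r (unique , inCell) =
      every-complete structure ρ (All.map sameCell (All.map⁻ inCell)) ,
      distinct-complete structure ρ unique
      where
      a∈c = proj₂ (All.head inCell)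
      sameCell : ∀ {y} → ρ y ∈ᶜ (r , c) → P (ρ v) (ρ y) ≡ true × Q (ρ a) (ρ y) ≡ true
      sameCell (y∈r , y∈c) = ≡⇒P (trans v∈r (sym y∈r)) , ≡⇒Q (trans a∈c (sym y∈c))

    columnCluster-sound : ∀ {k c} v a (as : Vec V k) → SatQF structure ρ (columnCluster v (a ∷ as)) →
                          InColumn c (ρ v) → Σ[ r ∈ R ] InRow r (ρ a) × suc k ≤ count r c
    columnCluster-sound {c = c} v a as (sameCell , dist) v∈c =
      r , a∈r , cluster-≤-count (distinct-sound structure ρ dist ,
                                 All.map⁺ (All.map inCell (every-sound structure ρ sameCell)))
      where
      r = proj₁ (cellOf (ρ a))
      a∈r = proj₁ (inColumn⇒∈ᶜ (trans (sym (Q⇒≡ (proj₁ (All.head (every-sound structure ρ sameCell))))) v∈c))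
      inCell : ∀ {y} → Q (ρ v) (ρ y) ≡ true × P (ρ a) (ρ y) ≡ true → ρ y ∈ᶜ (r , c)
      inCell (qvy , pay) = trans (sym (P⇒≡ pay)) a∈r , trans (sym (Q⇒≡ qvy)) v∈c

    columnCluster-complete : ∀ {k r c} v a (as : Vec V k) → InColumn c (ρ v) →
                             Cluster (r , c) (map ρ (a ∷ as)) →
                             SatQF structure ρ (columnCluster v (a ∷ as))
    columnCluster-complete {r = r} {c} v a as v∈c (unique , inCell) =
      every-complete structure ρ (All.map sameCell (All.map⁻ inCell)) ,
      distinct-complete structure ρ unique
      where
      a∈r = proj₁ (All.head inCell)
      sameCell : ∀ {y} → ρ y ∈ᶜ (r , c) → Q (ρ v) (ρ y) ≡ true × P (ρ a) (ρ y) ≡ true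
      sameCell (y∈r , y∈c) = ≡⇒Q (trans v∈c (sym y∈c)) , ≡⇒P (trans a∈r (sym y∈r))

    link-sound : ∀ {r c} x z y → SatQF structure ρ (link x z y) →
                 InRow r (ρ x) → InColumn c (ρ y) → 0 < count r c
    link-sound x z y (pxz , qzy) x∈r y∈c = occupied (trans (sym (P⇒≡ pxz)) x∈r , trans (Q⇒≡ qzy) y∈c)

    link-complete : ∀ {r c} x z y → InRow r (ρ x) → InColumn c (ρ y) → ρ z ∈ᶜ (r , c) →
                    SatQF structure ρ (link x z y)
    link-complete x z y x∈r y∈c (z∈r , z∈c) = ≡⇒P (trans x∈r (sym z∈r)) , ≡⇒Q (trans z∈c (sym y∈c))

    clustered⇒inRow : ∀ {k} v a b (as : Vec V k) → SatQF structure ρ (rowCluster v (a ∷ b ∷ as)) →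
                      Σ[ r ∈ R ] InRow r (ρ v)
    clustered⇒inRow v a b as (((pva , _) , (pvb , _) , _) , dist) with inRow-or-isolated (ρ v)
    ... | inj₁ v∈r      = v∈r
    ... | inj₂ isolated = contradiction (trans (isolated pva) (sym (isolated pvb))) a≢b
      where
      a≢b : ρ a ≢ ρ b
      a≢b with (a≢b ∷ _) ∷ _ ← distinct-sound structure ρ dist = a≢b

    anchor-sound : ∀ v a b c t s → SatQF structure ρ (anchor v a b c t s) →
                   Σ[ r ∈ R ] Σ[ c₀ ∈ C ] ρ v ∈ᶜ (r , c₀) × Anchored r c₀
    anchor-sound v a b c t s (cl , ¬qva , qta , ¬ptv , lnk)
      with r , v∈r ← clustered⇒inRow v a b (c ∷ []) cl
      with c′ , a∈c′ , 3≤count ← rowCluster-sound v a (b ∷ c ∷ []) cl v∈r =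
      r , c₀ , v∈ , c′ , r′ , c′≢c₀ , 3≤count , r′≢r , occupied t∈ , link-sound t s v lnk (proj₁ t∈) (proj₂ v∈)
      where
      v∈ = inRow⇒∈ᶜ v∈r
      c₀ = proj₂ (cellOf (ρ v))
      t∈ = inColumn⇒∈ᶜ (trans (Q⇒≡ qta) a∈c′)
      r′ = proj₁ (cellOf (ρ t))
      c′≢c₀ : c′ ≢ c₀
      c′≢c₀ refl = ¬qva (≡⇒Q (trans (proj₂ v∈) (sym a∈c′)))
      r′≢r : r′ ≢ r
      r′≢r refl = ¬ptv (≡⇒P (trans (proj₁ t∈) (sym v∈r)))

    anchor-complete : ∀ {r c₀ c′ r′} v a b c t s → ρ v ∈ᶜ (r , c₀) →
                      Cluster (r , c′) (map ρ (a ∷ b ∷ c ∷ [])) → c′ ≢ c₀ →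
                      ρ t ∈ᶜ (r′ , c′) → r′ ≢ r → ρ s ∈ᶜ (r′ , c₀) →
                      SatQF structure ρ (anchor v a b c t s)
    anchor-complete v a b c t s (v∈r , v∈c₀) cl c′≢c₀ (t∈r′ , t∈c′) r′≢r s∈ =
      rowCluster-complete v a (b ∷ c ∷ []) v∈r cl ,
      (λ qva → c′≢c₀ (inj₁-injective (trans (sym a∈c′) (trans (sym (Q⇒≡ qva)) v∈c₀)))) ,
      ≡⇒Q (trans t∈c′ (sym a∈c′)) ,
      (λ ptv → r′≢r (inj₁-injective (trans (sym t∈r′) (trans (P⇒≡ ptv) v∈r)))) ,
      link-complete t s v t∈r′ v∈c₀ s∈
      where
      a∈c′ = proj₂ (All.head (proj₂ cl))

  φ-domain-sound : ∀ {x} → SatΣ₁ structure φ-domain (one x) →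
                   Σ[ r ∈ R ] Σ[ c ∈ C ] x ∈ᶜ (r , c) × Anchored r c
  φ-domain-sound {x} (w , sat) =
    anchor-sound [ one x , w ] var₀ (ω (# 0)) (ω (# 1)) (ω (# 2)) (ω (# 3)) (ω (# 4)) sat

  φ-domain-complete : ∀ {x r c} → x ∈ᶜ (r , c) → Anchored r c → SatΣ₁ structure φ-domain (one x)
  φ-domain-complete {x} {r} {c} x∈ (c′ , r′ , c′≢c , 3≤count , r′≢r , occupied′ , occupied) =
    w , anchor-complete [ one x , w ] var₀ (ω (# 0)) (ω (# 1)) (ω (# 2)) (ω (# 3)) (ω (# 4))
          x∈ (firstMembers-cluster 3≤4 3≤count) c′≢c (member-∈ᶜ occupied′) r′≢r (member-∈ᶜ occupied)
    where
    w = lookup (firstMembers r c′ 3≤4 (# 0) ∷ firstMembers r c′ 3≤4 (# 1) ∷ firstMembers r c′ 3≤4 (# 2) ∷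
                member r′ c′ zero ∷ member r′ c zero ∷ [])

  φ-left-sound : ∀ {x r} → SatΣ₁ structure φ-left (one x) → InRow r x → Σ[ c ∈ C ] 4 ≤ count r c
  φ-left-sound {x} (w , sat) x∈r =
    map₂ proj₂ (rowCluster-sound [ one x , w ] var₀ (ω (# 0)) (ω (# 1) ∷ ω (# 2) ∷ ω (# 3) ∷ []) sat x∈r)

  φ-left-complete : ∀ {x r} c → InRow r x → 4 ≤ count r c → SatΣ₁ structure φ-left (one x)
  φ-left-complete {x} {r} c x∈r 4≤count =
    w , rowCluster-complete [ one x , w ] var₀ (ω (# 0)) (ω (# 1) ∷ ω (# 2) ∷ ω (# 3) ∷ [])
          x∈r (firstMembers-cluster ≤-refl 4≤count)
    where
    w = firstMembers r c ≤-refl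

  φ-right-sound : ∀ {x c} → SatΣ₁ structure φ-right (one x) → InColumn c x → Σ[ r ∈ R ] 2 ≤ count r c
  φ-right-sound {x} (w , sat) x∈c =
    map₂ proj₂ (columnCluster-sound [ one x , w ] var₀ (ω (# 0)) (ω (# 1) ∷ []) sat x∈c)

  φ-right-complete : ∀ {x c} r → InColumn c x → 2 ≤ count r c → SatΣ₁ structure φ-right (one x)
  φ-right-complete {x} {c} r x∈c 2≤count =
    w , columnCluster-complete [ one x , w ] var₀ (ω (# 0)) (ω (# 1) ∷ [])
          x∈c (firstMembers-cluster 2≤4 2≤count)
    where
    w = firstMembers r c 2≤4

  φ-edge-sound : ∀ {x y r c} → SatΣ₁ structure φ-edge (two x y) → InRow r x → InColumn c y →
                 (Σ[ c′ ∈ C ] 4 ≤ count r c′) × x ≢ y × 0 < count r c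
  φ-edge-sound {x} {y} (w , cl , x≢y , lnk) x∈r y∈c =
    map₂ proj₂ (rowCluster-sound ρ var₀ (ω (# 0)) (ω (# 1) ∷ ω (# 2) ∷ ω (# 3) ∷ []) cl x∈r) ,
    x≢y , link-sound ρ var₀ (ω (# 4)) var₁ lnk x∈r y∈c
    where
    ρ = [ two x y , w ]

  φ-edge-complete : ∀ {x y r c} c′ → InRow r x → 4 ≤ count r c′ → x ≢ y → InColumn c y →
                    0 < count r c → SatΣ₁ structure φ-edge (two x y)
  φ-edge-complete {x} {y} {r} {c} c′ x∈r 4≤count x≢y y∈c occupied =
    w , rowCluster-complete ρ var₀ (ω (# 0)) (ω (# 1) ∷ ω (# 2) ∷ ω (# 3) ∷ [])
          x∈r (firstMembers-cluster ≤-refl 4≤count) ,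
        x≢y , link-complete ρ var₀ (ω (# 4)) var₁ x∈r y∈c (member-∈ᶜ occupied)
    where
    w = lookup (firstMembers r c′ ≤-refl (# 0) ∷ firstMembers r c′ ≤-refl (# 1) ∷
                firstMembers r c′ ≤-refl (# 2) ∷ firstMembers r c′ ≤-refl (# 3) ∷ member r c zero ∷ [])
    ρ = [ two x y , w ]

  NonedgeWitness : R → C → Set
  NonedgeWitness r c = (Σ[ r′ ∈ R ] 2 ≤ count r′ c) ⊎ (Σ[ c′ ∈ C ] 4 ≤ count r c′) ⊎ 0 < count r c

  φ-nonedge-sound : ∀ {x y r c} → SatΣ₁ structure φ-nonedge (two x y) → InColumn c x → InRow r y →
                    NonedgeWitness r c
  φ-nonedge-sound {x} {y} (w , inj₁ cl) x∈c y∈r =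
    inj₁ (map₂ proj₂ (columnCluster-sound [ two x y , w ] var₀ (ω (# 0)) (ω (# 1) ∷ []) cl x∈c))
  φ-nonedge-sound {x} {y} (w , inj₂ (inj₁ cl)) x∈c y∈r =
    inj₂ (inj₁ (map₂ proj₂
      (rowCluster-sound [ two x y , w ] var₁ (ω (# 2)) (ω (# 3) ∷ ω (# 4) ∷ ω (# 5) ∷ []) cl y∈r)))
  φ-nonedge-sound {x} {y} (w , inj₂ (inj₂ lnk)) x∈c y∈r =
    inj₂ (inj₂ (link-sound [ two x y , w ] var₁ (ω (# 6)) var₀ lnk y∈r x∈c))

  φ-nonedge-complete : ∀ {x y r c} → InColumn c x → InRow r y → NonedgeWitness r c →
                       SatΣ₁ structure φ-nonedge (two x y)
  φ-nonedge-complete {x} {y} {c = c} x∈c y∈r (inj₁ (r′ , 2≤count)) =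
    w , inj₁ (columnCluster-complete [ two x y , w ] var₀ (ω (# 0)) (ω (# 1) ∷ [])
                x∈c (firstMembers-cluster 2≤4 2≤count))
    where
    w = lookup (firstMembers r′ c 2≤4 (# 0) ∷ firstMembers r′ c 2≤4 (# 1) ∷ x ∷ x ∷ x ∷ x ∷ x ∷ [])
  φ-nonedge-complete {x} {y} {r} x∈c y∈r (inj₂ (inj₁ (c′ , 4≤count))) =
    w , inj₂ (inj₁ (rowCluster-complete [ two x y , w ] var₁ (ω (# 2)) (ω (# 3) ∷ ω (# 4) ∷ ω (# 5) ∷ [])
                      y∈r (firstMembers-cluster ≤-refl 4≤count)))
    where
    w = lookup (x ∷ x ∷ firstMembers r c′ ≤-refl (# 0) ∷ firstMembers r c′ ≤-refl (# 1) ∷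
                firstMembers r c′ ≤-refl (# 2) ∷ firstMembers r c′ ≤-refl (# 3) ∷ x ∷ [])
  φ-nonedge-complete {x} {y} {r} {c} x∈c y∈r (inj₂ (inj₂ occupied)) =
    w , inj₂ (inj₂ (link-complete [ two x y , w ] var₁ (ω (# 6)) var₀ y∈r x∈c (member-∈ᶜ occupied)))
    where
    w = lookup (x ∷ x ∷ x ∷ x ∷ x ∷ x ∷ member r c zero ∷ [])

if-yes : ∀ {A : Set} (d : Dec A) {m k : ℕ} → A → (if does d then m else k) ≡ m
if-yes (yes _) _ = refl
if-yes (no ¬a) a = contradiction a ¬a

if-≥ : ∀ {A : Set} (d : Dec A) {j m : ℕ} → suc j ≤ (if does d then m else 0) → A × suc j ≤ m
if-≥ (yes a) h = a , h

Line : ℕ → Set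
Line n = Fin n ⊎ Fin n

pattern vert i = inj₁ i
pattern aux  i = inj₂ i

module BipartiteTable {n : ℕ} (L : Fin n → Bool) (E : Fin n → Fin n → Bool) where

  -- The cell (vert i , vert j) is occupied for an edge i j, and also for a non-edge
  -- j i from a left j to a right i: read from a left i it lists the edges, read from
  -- a right i the non-edges.
  linked : Fin n → Fin n → Bool
  linked i j = E i j ∨ᵇ (not (L i) ∧ᵇ L j ∧ᵇ not (E j i))

  onDiagonal : Fin n → Fin n → ℕ → ℕ
  onDiagonal i j m = if does (i ≟ j) then m else 0

  table : Line n → Line n → ℕ
  table (vert i) (vert j) = if does (i ≟ j) ∨ᵇ linked i j then 1 else 0
  table (vert i) (aux j)  = onDiagonal i j (if L i then 4 else 3)
  table (aux i)  (vert j) = onDiagonal i j (if L i then 1 else 2)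
  table (aux i)  (aux j)  = onDiagonal i j 1

  index : Fin (((n + n) * (n + n)) * 4) ↔ ((Line n × Line n) × Fin 4)
  index = ((+↔⊎ ×-↔ +↔⊎) ×-↔ ↔-refl) ↔-∘ ((*↔× ×-↔ ↔-refl) ↔-∘ *↔×)

  open Table (⊎-≡-dec _≟_ _≟_) (⊎-≡-dec _≟_ _≟_) index table public

  onDiagonal-≥ : ∀ i j {k m} → suc k ≤ onDiagonal i j m → i ≡ j × suc k ≤ m
  onDiagonal-≥ i j = if-≥ (i ≟ j)

  onDiagonal-≤ : ∀ i j {m k} → m ≤ k → onDiagonal i j m ≤ k
  onDiagonal-≤ i j m≤k with does (i ≟ j)
  ... | true  = m≤k
  ... | false = z≤n

  onDiagonal-refl : ∀ i {m} → onDiagonal i i m ≡ m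
  onDiagonal-refl i = if-yes (i ≟ i) refl

  vertexCell≤1 : ∀ i j → table (vert i) (vert j) ≤ 1
  vertexCell≤1 i j with does (i ≟ j) ∨ᵇ linked i j
  ... | true  = s≤s z≤n
  ... | false = z≤n

  auxRow≤2 : ∀ i c → table (aux i) c ≤ 2
  auxRow≤2 i (vert j) with L i
  ... | true  = onDiagonal-≤ i j (s≤s z≤n)
  ... | false = onDiagonal-≤ i j ≤-refl
  auxRow≤2 i (aux j) = onDiagonal-≤ i j (s≤s z≤n)

  3≤table⇒leftMarker : ∀ r c → 3 ≤ table r c → Σ[ i ∈ Fin n ] r ≡ vert i × c ≡ aux i
  3≤table⇒leftMarker (vert i) (vert j) h = contradiction (≤-trans h (vertexCell≤1 i j)) λ { (s≤s ()) }
  3≤table⇒leftMarker (vert i) (aux j)  h with refl , _ ← onDiagonal-≥ i j h = i , refl , refl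
  3≤table⇒leftMarker (aux i)  c        h = contradiction (≤-trans h (auxRow≤2 i c)) λ { (s≤s (s≤s ())) }

  4≤table⇒left : ∀ i c → 4 ≤ table (vert i) c → L i ≡ true
  4≤table⇒left i c h with 3≤table⇒leftMarker (vert i) c (≤-trans 3≤4 h)
  ... | _ , refl , refl = marked (L i) (proj₂ (onDiagonal-≥ i i h))
    where
    marked : ∀ b → 4 ≤ (if b then 4 else 3) → b ≡ true
    marked true  _ = refl
    marked false (s≤s (s≤s (s≤s ())))

  2≤table⇒right : ∀ r j → 2 ≤ table r (vert j) → r ≡ aux j × L j ≡ false
  2≤table⇒right (vert i) j h = contradiction (≤-trans h (vertexCell≤1 i j)) λ { (s≤s ()) }
  2≤table⇒right (aux i)  j h with refl , h′ ← onDiagonal-≥ i j h = refl , marked (L i) h′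
    where
    marked : ∀ b → 2 ≤ (if b then 1 else 2) → b ≡ false
    marked false _ = refl
    marked true  (s≤s ())

  occupied-auxColumn : ∀ r i → 0 < table r (aux i) → r ≡ vert i ⊎ r ≡ aux i
  occupied-auxColumn (vert j) i h with refl , _ ← onDiagonal-≥ j i h = inj₁ refl
  occupied-auxColumn (aux j)  i h with refl , _ ← onDiagonal-≥ j i h = inj₂ refl

  occupied-auxRow : ∀ i c → 0 < table (aux i) c → c ≡ vert i ⊎ c ≡ aux i
  occupied-auxRow i (vert j) h with refl , _ ← onDiagonal-≥ i j h = inj₁ refl
  occupied-auxRow i (aux j)  h with refl , _ ← onDiagonal-≥ i j h = inj₂ refl

  occupied-vertexCell : ∀ i j → 0 < table (vert i) (vert j) → i ≡ j ⊎ linked i j ≡ true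
  occupied-vertexCell i j h with i ≟ j | linked i j
  ... | yes i≡j | _     = inj₁ i≡j
  ... | no _    | true  = inj₂ refl
  ... | no _    | false = contradiction h λ ()

  vertexCell-occupied : ∀ i → 0 < table (vert i) (vert i)
  vertexCell-occupied i with i ≟ i
  ... | yes _   = s≤s z≤n
  ... | no i≢i = contradiction refl i≢i

  linked⇒occupied : ∀ {i j} → linked i j ≡ true → 0 < table (vert i) (vert j)
  linked⇒occupied {i} {j} linked-ij rewrite linked-ij | ∨-zeroʳ (does (i ≟ j)) = s≤s z≤n

  leftMarker≥3 : ∀ i → 3 ≤ table (vert i) (aux i)
  leftMarker≥3 i rewrite onDiagonal-refl i {if L i then 4 else 3} with L i
  ... | true  = 3≤4
  ... | false = ≤-refl

  leftMarker≥4 : ∀ i → L i ≡ true → 4 ≤ table (vert i) (aux i)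
  leftMarker≥4 i left rewrite onDiagonal-refl i {if L i then 4 else 3} | left = ≤-refl

  rightMarker≥2 : ∀ i → L i ≡ false → 2 ≤ table (aux i) (vert i)
  rightMarker≥2 i right rewrite onDiagonal-refl i {if L i then 1 else 2} | right = ≤-refl

  rightMarker-occupied : ∀ i → 0 < table (aux i) (vert i)
  rightMarker-occupied i rewrite onDiagonal-refl i {if L i then 1 else 2} with L i
  ... | true  = ≤-refl
  ... | false = s≤s z≤n

  auxCell-occupied : ∀ i → 0 < table (aux i) (aux i)
  auxCell-occupied i rewrite onDiagonal-refl i {1} = ≤-refl

  anchored⇒vertexCell : ∀ r c → Anchored r c → Σ[ i ∈ Fin n ] r ≡ vert i × c ≡ vert i
  anchored⇒vertexCell r c (c′ , r′ , c′≢c , 3≤count , r′≢r , occupied′ , occupied)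
    with i , refl , refl ← 3≤table⇒leftMarker r c′ 3≤count
    with occupied-auxColumn r′ i occupied′
  ... | inj₁ refl = contradiction refl r′≢r
  ... | inj₂ refl with occupied-auxRow i c occupied
  ...   | inj₁ refl = i , refl , refl
  ...   | inj₂ refl = contradiction refl c′≢c

  vertexCell-anchored : ∀ i → Anchored (vert i) (vert i)
  vertexCell-anchored i =
    aux i , aux i , (λ ()) , leftMarker≥3 i , (λ ()) , auxCell-occupied i , rightMarker-occupied i

  vertex : Fin n → Fin (((n + n) * (n + n)) * 4)
  vertex i = member (vert i) (vert i) zero

  vertex-∈ᶜ : ∀ i → vertex i ∈ᶜ (vert i , vert i)
  vertex-∈ᶜ i = member-∈ᶜ (vertexCell-occupied i)

  vertex-injective : ∀ i j → vertex i ≡ vertex j → i ≡ j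
  vertex-injective i j same =
    inj₁-injective (cong (proj₁ ∘ proj₁) (member-injective {vert i} {vert i} {vert j} {vert j} same))

  domain⇒vertex : ∀ x → SatΣ₁ structure φ-domain (one x) → Σ[ i ∈ Fin n ] vertex i ≡ x
  domain⇒vertex x sat = vertexOf (φ-domain-sound sat)
    where
    vertexOf : Σ[ r ∈ Line n ] Σ[ c ∈ Line n ] x ∈ᶜ (r , c) × Anchored r c → Σ[ i ∈ Fin n ] vertex i ≡ x
    vertexOf (r , c , x∈ , anchored) with anchored⇒vertexCell r c anchored
    ... | i , refl , refl = i , sym (∈ᶜ-singleton (vertexCell≤1 i i) x∈)

  vertex-domain : ∀ i → SatΣ₁ structure φ-domain (one (vertex i))
  vertex-domain i = φ-domain-complete (vertex-∈ᶜ i) (vertexCell-anchored i)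

  vertex-left : ∀ i → SatΣ₁ structure φ-left (one (vertex i)) ⇔ₛ (L i ≡ true)
  vertex-left i =
    (λ sat → uncurry (4≤table⇒left i) (φ-left-sound sat (proj₁ (vertex-∈ᶜ i)))) ,
    (λ left → φ-left-complete (aux i) (proj₁ (vertex-∈ᶜ i)) (leftMarker≥4 i left))

  vertex-right : ∀ i → SatΣ₁ structure φ-right (one (vertex i)) ⇔ₛ (L i ≡ false)
  vertex-right i =
    (λ sat → proj₂ (uncurry (λ r → 2≤table⇒right r i) (φ-right-sound sat (proj₂ (vertex-∈ᶜ i))))) ,
    (λ right → φ-right-complete (aux i) (proj₂ (vertex-∈ᶜ i)) (rightMarker≥2 i right))

  Bipartite : Set
  Bipartite = ∀ i j → E i j ≡ true → L i ≡ true × L j ≡ false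

  left≢right : ∀ {i j} → L i ≡ true → L j ≡ false → i ≢ j
  left≢right left right refl = contradiction (trans (sym left) right) λ ()

  linked-cases : ∀ i j → linked i j ≡ true → E i j ≡ true ⊎ (L i ≡ false × L j ≡ true × E j i ≡ false)
  linked-cases i j = cases (E i j) (L i) (L j) (E j i)
    where
    cases : ∀ e lᵢ lⱼ e′ → e ∨ᵇ (not lᵢ ∧ᵇ lⱼ ∧ᵇ not e′) ≡ true →
            e ≡ true ⊎ (lᵢ ≡ false × lⱼ ≡ true × e′ ≡ false)
    cases true  _     _     _     _ = inj₁ refl
    cases false false true  false _ = inj₂ (refl , refl , refl)
    cases false true  _     _     ()
    cases false false false _     ()
    cases false false true  true  ()

  edge⇒linked : ∀ {i j} → E i j ≡ true → linked i j ≡ true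
  edge⇒linked edge rewrite edge = refl

  nonedge-cases : ∀ i j → ¬ E i j ≡ true → L i ≡ false ⊎ L j ≡ true ⊎ linked j i ≡ true
  nonedge-cases i j ¬edge with L i | L j | E i j
  ... | false | _     | _     = inj₁ refl
  ... | true  | true  | _     = inj₂ (inj₁ refl)
  ... | true  | false | true  = contradiction refl ¬edge
  ... | true  | false | false = inj₂ (inj₂ (∨-zeroʳ (E j i)))

  leftRowCell⇒edge : ∀ {i j} → L i ≡ true → 0 < table (vert i) (vert j) → i ≢ j → E i j ≡ true
  leftRowCell⇒edge {i} {j} left occupied i≢j with occupied-vertexCell i j occupied
  ... | inj₁ i≡j = contradiction i≡j i≢j
  ... | inj₂ linked-ij with linked-cases i j linked-ij
  ...   | inj₁ edge        = edge
  ...   | inj₂ (right , _) = contradiction refl (left≢right left right)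

  transposedCell⇒nonedge : Bipartite → ∀ {i j} → 0 < table (vert j) (vert i) → ¬ E i j ≡ true
  transposedCell⇒nonedge bipartite {i} {j} occupied edge with occupied-vertexCell j i occupied
  ... | inj₁ refl = left≢right (proj₁ (bipartite i i edge)) (proj₂ (bipartite i i edge)) refl
  ... | inj₂ linked-ji with linked-cases j i linked-ji
  ...   | inj₁ edge-ji         = left≢right (proj₁ (bipartite i j edge)) (proj₂ (bipartite j i edge-ji)) refl
  ...   | inj₂ (_ , _ , ¬edge) = contradiction (trans (sym edge) ¬edge) λ ()

  vertex-edge : Bipartite → ∀ i j → SatΣ₁ structure φ-edge (two (vertex i) (vertex j)) ⇔ₛ (E i j ≡ true)
  vertex-edge bipartite i j = sound , complete
    where
    sound : SatΣ₁ structure φ-edge (two (vertex i) (vertex j)) → E i j ≡ true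
    sound sat = edge (φ-edge-sound sat (proj₁ (vertex-∈ᶜ i)) (proj₂ (vertex-∈ᶜ j)))
      where
      edge : (Σ[ c ∈ Line n ] 4 ≤ table (vert i) c) × vertex i ≢ vertex j × 0 < table (vert i) (vert j) →
             E i j ≡ true
      edge ((c , 4≤count) , distinct , occupied) =
        leftRowCell⇒edge (4≤table⇒left i c 4≤count) occupied (distinct ∘ cong vertex)

    complete : E i j ≡ true → SatΣ₁ structure φ-edge (two (vertex i) (vertex j))
    complete edge =
      φ-edge-complete (aux i) (proj₁ (vertex-∈ᶜ i)) (leftMarker≥4 i left)
                      (left≢right left right ∘ vertex-injective i j)
                      (proj₂ (vertex-∈ᶜ j)) (linked⇒occupied (edge⇒linked edge))
      where
      left = proj₁ (bipartite i j edge)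
      right = proj₂ (bipartite i j edge)

  vertex-nonedge : Bipartite → ∀ i j →
                   SatΣ₁ structure φ-nonedge (two (vertex i) (vertex j)) ⇔ₛ (¬ E i j ≡ true)
  vertex-nonedge bipartite i j = sound , complete
    where
    sound : SatΣ₁ structure φ-nonedge (two (vertex i) (vertex j)) → ¬ E i j ≡ true
    sound sat = excluded (φ-nonedge-sound sat (proj₂ (vertex-∈ᶜ i)) (proj₁ (vertex-∈ᶜ j)))
      where
      excluded : NonedgeWitness (vert j) (vert i) → ¬ E i j ≡ true
      excluded (inj₁ (r , 2≤count)) edge =
        left≢right (proj₁ (bipartite i j edge)) (proj₂ (2≤table⇒right r i 2≤count)) refl
      excluded (inj₂ (inj₁ (c , 4≤count))) edge =
        left≢right (4≤table⇒left j c 4≤count) (proj₂ (bipartite i j edge)) refl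
      excluded (inj₂ (inj₂ occupied)) = transposedCell⇒nonedge bipartite occupied

    complete : ¬ E i j ≡ true → SatΣ₁ structure φ-nonedge (two (vertex i) (vertex j))
    complete ¬edge = φ-nonedge-complete (proj₂ (vertex-∈ᶜ i)) (proj₁ (vertex-∈ᶜ j)) witness
      where
      witness : NonedgeWitness (vert j) (vert i)
      witness with nonedge-cases i j ¬edge
      ... | inj₁ right         = inj₁ (aux i , rightMarker≥2 i right)
      ... | inj₂ (inj₁ left)   = inj₂ (inj₁ (aux j , leftMarker≥4 j left))
      ... | inj₂ (inj₂ linked) = inj₂ (inj₂ (linked⇒occupied linked))

module _ {𝔄 : Str₁} (big : InBiG* 𝔄) where
  open Str₁ 𝔄 using (L; R; E)
  open BipartiteTable L E

  left⇔¬right : ∀ a → (L a ≡ true) ⇔ₛ (¬ R a ≡ true)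
  left⇔¬right = proj₁ big

  right⇔¬left : ∀ a → (R a ≡ true) ⇔ₛ (L a ≡ false)
  right⇔¬left a =
    (λ right → ¬-not (λ left → proj₁ (left⇔¬right a) left right)) ,
    (λ ¬left → decidable-stable (R a Bool.≟ true)
                 (λ ¬right → not-¬ ¬left (proj₂ (left⇔¬right a) ¬right)))

  edges-bipartite : Bipartite
  edges-bipartite i j edge =
    proj₁ (proj₁ (proj₂ big) i j edge) , proj₁ (right⇔¬left j) (proj₂ (proj₁ (proj₂ big) i j edge))

  bigraph-copy : DefinableCopy scheme 𝔄 structure
  bigraph-copy = record
    { embed           = vertex
    ; embed-injective = vertex-injective
    ; embed-domain    = vertex-domain
    ; domain-embed    = domain⇒vertex
    ; defines-L       = vertex-left
    ; defines-¬L      = λ a → ⇔ₛ-trans (vertex-right a) (not-¬ , ¬-not)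
    ; defines-R       = λ a → ⇔ₛ-trans (vertex-right a) (⇔ₛ-sym (right⇔¬left a))
    ; defines-¬R      = λ a → ⇔ₛ-trans (vertex-left a) (left⇔¬right a)
    ; defines-E       = vertex-edge edges-bipartite
    ; defines-¬E      = vertex-nonedge edges-bipartite
    }

theorem1 : BiG*Σ₁InterpretableIn2Eq
theorem1 = scheme , λ 𝔄 big →
  let open Str₁ 𝔄 using (L; E)
      (someLeft , _) = proj₁ (proj₂ (proj₂ big))
  in BipartiteTable.structure L E , BipartiteTable.structure-in2Eq L E ,
     DefinableCopy.interprets (bigraph-copy big) someLeft
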